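{- Let $m \geq 3$ and $n \ge 3$, and write $m = 3k + \ell$ with $\ell\in\{0,1,2\}$. Then $$\gamma_{r2}(C_{m} \Box C_n) \ge kn + \ell\, \frac{n}{2}=\frac{mn}{3}+\ell\, \frac{n}{6}.$$
   Context: A 2-rainbow dominating function (2RDF) of a graph $G$ assigns to each vertex a subset of $\{1,2\}$ so that every vertex $v$ with $f(v)=\emptyset$ satisfies $\bigcup_{u\in N(v)} f(u)=\{1,2\}$; its weight is $\sum_v |f(v)|$ and $\gamma_{r2}(G)$ is the minimum weight of a 2RDF of $G$. $C_m \Box C_n$ is the Cartesian product of the cycles $C_m$ and $C_n$. -}

module Defs where

open import Data.Nat using (ℕ; zero; suc; _+_; _*_; _≥_)
open import Data.Nat.DivMod using (_%_; _/_)
open import Data.Fin using (Fin; toℕ)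
open import Data.Bool using (Bool; true; false)
open import Data.Product using (_×_; _,_; ∃-syntax)
open import Data.Empty using (⊥)
open import Data.Sum using (_⊎_)
open import Data.List using (List; map; allFin)
open import Data.Nat.ListAction using (sum)
open import Relation.Binary.PropositionalEquality using (_≡_)

-- A subset of {1,2}, given by its two membership bits (contains 1, contains 2).
Label : Set
Label = Bool × Bool

has1 : Label → Bool
has1 (a , _) = a

has2 : Label → Bool
has2 (_ , b) = b

card : Label → ℕ
card (a , b) = b2n a + b2n b
  where
  b2n : Bool → ℕ
  b2n true  = 1
  b2n false = 0

empty : Label
empty = (false , false)

CycAdj : (m : ℕ) → Fin m → Fin m → Set
CycAdj zero    i j = ⊥
CycAdj (suc p) i j =
  (toℕ j ≡ suc (toℕ i) % suc p) ⊎ (toℕ i ≡ suc (toℕ j) % suc p)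

Vtx : ℕ → ℕ → Set
Vtx m n = Fin m × Fin n

Adj : (m n : ℕ) → Vtx m n → Vtx m n → Set
Adj m n (i , j) (i' , j') = (i ≡ i' × CycAdj n j j') ⊎ (j ≡ j' × CycAdj m i i')

Is2RDF : (m n : ℕ) → (Vtx m n → Label) → Set
Is2RDF m n f = (v : Vtx m n) → f v ≡ empty →
  (∃[ u ] (Adj m n v u × has1 (f u) ≡ true)) ×
  (∃[ u ] (Adj m n v u × has2 (f u) ≡ true))

weight : (m n : ℕ) → (Vtx m n → Label) → ℕ
weight m n f = sum (map (λ i → sum (map (λ j → card (f (i , j))) (allFin n))) (allFin m))

{-# OPTIONS --safe #-}
-- Every vertex v satisfies 2|f(v)| + Σ_{u ∼ v} |f(u)| ≥ 2: either f(v) ≠ ∅, or the neighbours of v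
-- carry both colours. Summing over a column of C_m □ C_n gives 2m ≤ c(j-1) + 4c(j) + c(j+1) for
-- the column weights c(j), which on average only yields Σ c ≥ mn/3. The extra comes from
-- integrality: with s = 2k + ℓ, a column with 2c(j) < s has c(j) ≤ k, and then the excesses
-- 2c(j±1) − s of its neighbours add up to at least twice its deficit s − 2c(j). If every column
-- hands half of its excess to each neighbour, all deficits are covered, so Σ 2c ≥ ns.
module Submission where

open import Defs
open import Data.Nat using (ℕ; _+_; _*_; _≤_)
open import Data.Nat.DivMod using (_%_; _/_)
open import Data.Nat using (zero; suc; _∸_; _<_; z≤n; s≤s; NonZero)
open import Data.Nat.Properties
open import Data.Nat.DivMod using (m%n<n; %-distribˡ-+; m%n%n≡m%n; [m+n]%n≡m%n; m<n⇒m%n≡m; m≡m%n+[m/n]*n)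
open import Data.Nat.Tactic.RingSolver using (solve-∀; solve)
import Data.Nat.ListAction as List
open import Data.Bool using (Bool; true; false)
open import Data.Fin using (Fin; toℕ; fromℕ<)
import Data.Fin as Fin
open import Data.Fin.Properties using (toℕ-fromℕ<; toℕ-injective; toℕ<n)
open import Data.Fin.Permutation using (Permutation′; permutation; flip)
open import Data.List using ([]; _∷_; map; tabulate; allFin)
open import Data.Product using (_,_)
open import Data.Sum using (_⊎_; inj₁; inj₂)
open import Algebra.Properties.Semiring.Sum +-*-semiring
  using (sum; sum-cong-≗; ∑-distrib-+; ∑-comm; ∑-permute; *-distribˡ-sum)
open import Function using (_∘_)
open import Relation.Binary.PropositionalEquality
open import Relation.Nullary using (yes; no)

next prev : ∀ {p} → Fin (suc p) → Fin (suc p)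
next {p} i = fromℕ< (m%n<n (suc (toℕ i)) (suc p))
prev {p} i = fromℕ< (m%n<n (toℕ i + p) (suc p))

[m%d+n]%d≡[m+n]%d : ∀ m n d .{{_ : NonZero d}} → (m % d + n) % d ≡ (m + n) % d
[m%d+n]%d≡[m+n]%d m n d = begin
  (m % d + n) % d           ≡⟨ %-distribˡ-+ (m % d) n d ⟩
  (m % d % d + n % d) % d   ≡⟨ cong (λ x → (x + n % d) % d) (m%n%n≡m%n m d) ⟩
  (m % d + n % d) % d       ≡⟨ %-distribˡ-+ m n d ⟨
  (m + n) % d               ∎
  where open ≡-Reasoning

toℕ-next : ∀ {p} (i : Fin (suc p)) → toℕ (next i) ≡ suc (toℕ i) % suc p
toℕ-next {p} i = toℕ-fromℕ< (m%n<n (suc (toℕ i)) (suc p))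

toℕ-prev : ∀ {p} (i : Fin (suc p)) → toℕ (prev i) ≡ (toℕ i + p) % suc p
toℕ-prev {p} i = toℕ-fromℕ< (m%n<n (toℕ i + p) (suc p))

[i+d]%d≡i : ∀ {p} (i : Fin (suc p)) → (toℕ i + suc p) % suc p ≡ toℕ i
[i+d]%d≡i i = trans ([m+n]%n≡m%n (toℕ i) _) (m<n⇒m%n≡m (toℕ<n i))

prev-next : ∀ {p} (i : Fin (suc p)) → prev (next i) ≡ i
prev-next {p} i = toℕ-injective (begin
  toℕ (prev (next i))                 ≡⟨ toℕ-prev (next i) ⟩
  (toℕ (next i) + p) % suc p          ≡⟨ cong (λ x → (x + p) % suc p) (toℕ-next i) ⟩
  (suc (toℕ i) % suc p + p) % suc p   ≡⟨ [m%d+n]%d≡[m+n]%d (suc (toℕ i)) p (suc p) ⟩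
  (suc (toℕ i) + p) % suc p           ≡⟨ cong (_% suc p) (+-suc (toℕ i) p) ⟨
  (toℕ i + suc p) % suc p             ≡⟨ [i+d]%d≡i i ⟩
  toℕ i                               ∎)
  where open ≡-Reasoning

next-prev : ∀ {p} (i : Fin (suc p)) → next (prev i) ≡ i
next-prev {p} i = toℕ-injective (begin
  toℕ (next (prev i))                 ≡⟨ toℕ-next (prev i) ⟩
  suc (toℕ (prev i)) % suc p          ≡⟨ cong (λ x → suc x % suc p) (toℕ-prev i) ⟩
  (1 + (toℕ i + p) % suc p) % suc p   ≡⟨ cong (_% suc p) (+-comm 1 _) ⟩
  ((toℕ i + p) % suc p + 1) % suc p   ≡⟨ [m%d+n]%d≡[m+n]%d (toℕ i + p) 1 (suc p) ⟩
  (toℕ i + p + 1) % suc p             ≡⟨ cong (_% suc p) (trans (+-assoc (toℕ i) p 1) (cong (toℕ i +_) (+-comm p 1))) ⟩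
  (toℕ i + suc p) % suc p             ≡⟨ [i+d]%d≡i i ⟩
  toℕ i                               ∎)
  where open ≡-Reasoning

rotation : ∀ {p} → Permutation′ (suc p)
rotation = permutation next prev next-prev prev-next

∑-next : ∀ {p} (h : Fin (suc p) → ℕ) → sum (h ∘ next) ≡ sum h
∑-next h = sym (∑-permute h rotation)

∑-prev : ∀ {p} (h : Fin (suc p) → ℕ) → sum (h ∘ prev) ≡ sum h
∑-prev h = sym (∑-permute h (flip rotation))

∑-mono-≤ : ∀ {n} {g h : Fin n → ℕ} → (∀ i → g i ≤ h i) → sum g ≤ sum h
∑-mono-≤ {zero}  _   = z≤n
∑-mono-≤ {suc n} g≤h = +-mono-≤ (g≤h Fin.zero) (∑-mono-≤ (g≤h ∘ Fin.suc))

∑-const : ∀ n c → sum {n} (λ _ → c) ≡ n * c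
∑-const zero    c = refl
∑-const (suc n) c = cong (c +_) (∑-const n c)

sum-map-tabulate : ∀ {n} {A : Set} (g : A → ℕ) (h : Fin n → A) → List.sum (map g (tabulate h)) ≡ sum (g ∘ h)
sum-map-tabulate {zero}  g h = refl
sum-map-tabulate {suc n} g h = cong (g (h Fin.zero) +_) (sum-map-tabulate g (h ∘ Fin.suc))

m+[n∸m]≡n+[m∸n] : ∀ m n → m + (n ∸ m) ≡ n + (m ∸ n)
m+[n∸m]≡n+[m∸n] zero    zero    = refl
m+[n∸m]≡n+[m∸n] zero    (suc n) = sym (+-identityʳ (suc n))
m+[n∸m]≡n+[m∸n] (suc m) zero    = +-identityʳ (suc m)
m+[n∸m]≡n+[m∸n] (suc m) (suc n) = cong suc (m+[n∸m]≡n+[m∸n] m n)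

-- Discharging on a cycle: each position hands half of its excess h ∸ s to each neighbour, and the
-- hypothesis says that this covers every deficit s ∸ h.
∑-discharging : ∀ {p} s (h : Fin (suc p) → ℕ) →
  (∀ j → 2 * (s ∸ h j) ≤ (h (prev j) ∸ s) + (h (next j) ∸ s)) →
  suc p * s ≤ sum h
∑-discharging {p} s h covered = +-cancelʳ-≤ (sum excess) _ _ (begin
  suc p * s + sum excess              ≡⟨ cong (_+ sum excess) (∑-const (suc p) s) ⟨
  sum {suc p} (λ _ → s) + sum excess  ≡⟨ ∑-distrib-+ (λ _ → s) excess ⟨
  sum (λ j → s + excess j)            ≡⟨ sum-cong-≗ (λ j → m+[n∸m]≡n+[m∸n] (h j) s) ⟨
  sum (λ j → h j + deficit j)         ≡⟨ ∑-distrib-+ h deficit ⟩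
  sum h + sum deficit                 ≤⟨ +-monoʳ-≤ (sum h) deficit≤excess ⟩
  sum h + sum excess                  ∎)
  where
  open ≤-Reasoning
  excess deficit : Fin (suc p) → ℕ
  excess  j = h j ∸ s
  deficit j = s ∸ h j
  deficit≤excess : sum deficit ≤ sum excess
  deficit≤excess = *-cancelˡ-≤ 2 (begin
    2 * sum deficit                                ≡⟨ *-distribˡ-sum 2 deficit ⟩
    sum (λ j → 2 * deficit j)                      ≤⟨ ∑-mono-≤ covered ⟩
    sum (λ j → excess (prev j) + excess (next j))  ≡⟨ ∑-distrib-+ (excess ∘ prev) (excess ∘ next) ⟩
    sum (excess ∘ prev) + sum (excess ∘ next)      ≡⟨ cong₂ _+_ (∑-prev excess) (∑-next excess) ⟩
    sum excess + sum excess                        ≡⟨ cong (sum excess +_) (+-identityʳ (sum excess)) ⟨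
    2 * sum excess                                 ∎)

2*b<2*k+ℓ⇒b≤k : ∀ {k ℓ b} → ℓ ≤ 2 → 2 * b < 2 * k + ℓ → b ≤ k
2*b<2*k+ℓ⇒b≤k {k} {ℓ} {b} ℓ≤2 2b<s = m<1+n⇒m≤n (*-cancelˡ-< 2 b (suc k) (begin-strict
  2 * b       <⟨ 2b<s ⟩
  2 * k + ℓ   ≤⟨ +-monoʳ-≤ (2 * k) ℓ≤2 ⟩
  2 * k + 2   ≡⟨ +-comm (2 * k) 2 ⟩
  2 + 2 * k   ≡⟨ *-suc 2 k ⟨
  2 * suc k   ∎))
  where open ≤-Reasoning

-- The hypothesis is the column inequality 2m ≤ a + 4b + c with m = 3k + ℓ, s = 2k + ℓ.
deficit-covered : ∀ s k a b c → (2 * b < s → b ≤ k) → 2 * s + 2 * k ≤ a + 4 * b + c →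
  2 * (s ∸ 2 * b) ≤ (2 * a ∸ s) + (2 * c ∸ s)
deficit-covered s k a b c integral hyp with 2 * b <? s
... | no 2b≮s = ≤-trans (≤-reflexive (cong (2 *_) (m≤n⇒m∸n≡0 (≮⇒≥ 2b≮s)))) z≤n
... | yes 2b<s = +-cancelʳ-≤ (8 * b + 2 * s) _ _ (begin
  2 * (s ∸ 2 * b) + (8 * b + 2 * s)             ≡⟨ unfold (s ∸ 2 * b) b s ⟩
  2 * (s ∸ 2 * b + 2 * b) + 4 * b + 2 * s       ≡⟨ cong (λ x → 2 * x + 4 * b + 2 * s) (m∸n+n≡m (<⇒≤ 2b<s)) ⟩
  2 * s + 4 * b + 2 * s                         ≤⟨ +-monoˡ-≤ (2 * s) (+-monoʳ-≤ (2 * s) (*-monoʳ-≤ 4 (integral 2b<s))) ⟩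
  2 * s + 4 * k + 2 * s                         ≡⟨ solve (s ∷ k ∷ []) ⟩
  2 * (2 * s + 2 * k)                           ≤⟨ *-monoʳ-≤ 2 hyp ⟩
  2 * (a + 4 * b + c)                           ≡⟨ solve (a ∷ b ∷ c ∷ []) ⟩
  2 * a + 2 * c + 8 * b                         ≤⟨ +-monoˡ-≤ (8 * b) (+-mono-≤ (m≤n+m∸n (2 * a) s) (m≤n+m∸n (2 * c) s)) ⟩
  s + (2 * a ∸ s) + (s + (2 * c ∸ s)) + 8 * b   ≡⟨ regroup s (2 * a ∸ s) (2 * c ∸ s) (8 * b) ⟩
  (2 * a ∸ s) + (2 * c ∸ s) + (8 * b + 2 * s)   ∎)
  where
  open ≤-Reasoning
  unfold : ∀ d b s → 2 * d + (8 * b + 2 * s) ≡ 2 * (d + 2 * b) + 4 * b + 2 * s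
  unfold = solve-∀
  regroup : ∀ s x y z → s + x + (s + y) + z ≡ x + y + (z + 2 * s)
  regroup = solve-∀

CycAdj⇒next⊎prev : ∀ {p} {i j : Fin (suc p)} → CycAdj (suc p) i j → j ≡ next i ⊎ j ≡ prev i
CycAdj⇒next⊎prev {i = i} (inj₁ j≡1+i) = inj₁ (toℕ-injective (trans j≡1+i (sym (toℕ-next i))))
CycAdj⇒next⊎prev {j = j} (inj₂ i≡1+j) =
  inj₂ (trans (sym (prev-next j)) (cong prev (toℕ-injective (trans (toℕ-next j) (sym i≡1+j)))))

nbrSum : ∀ {p q} → (Vtx (suc p) (suc q) → ℕ) → Vtx (suc p) (suc q) → ℕ
nbrSum g (i , j) = g (prev i , j) + g (next i , j) + g (i , prev j) + g (i , next j)

Adj⇒≤nbrSum : ∀ {p q} (g : Vtx (suc p) (suc q) → ℕ) {v u} → Adj (suc p) (suc q) v u → g u ≤ nbrSum g v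
Adj⇒≤nbrSum g {i , j} (inj₁ (refl , j~j′)) with CycAdj⇒next⊎prev j~j′
... | inj₁ refl = m≤n+m (g (i , next j)) _
... | inj₂ refl = ≤-trans (m≤n+m (g (i , prev j)) _) (m≤m+n _ (g (i , next j)))
Adj⇒≤nbrSum g {i , j} (inj₂ (refl , i~i′)) with CycAdj⇒next⊎prev i~i′
... | inj₁ refl = ≤-trans (m≤n+m (g (next i , j)) (g (prev i , j)))
                    (≤-trans (m≤m+n _ (g (i , prev j))) (m≤m+n _ (g (i , next j))))
... | inj₂ refl = ≤-trans (m≤m+n (g (prev i , j)) (g (next i , j)))
                    (≤-trans (m≤m+n _ (g (i , prev j))) (m≤m+n _ (g (i , next j))))

nbrSum-cong : ∀ {p q} {g h : Vtx (suc p) (suc q) → ℕ} → (∀ u → g u ≡ h u) → ∀ v → nbrSum g v ≡ nbrSum h v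
nbrSum-cong g≗h (i , j) = cong₂ _+_ (cong₂ _+_ (cong₂ _+_ (g≗h _) (g≗h _)) (g≗h _)) (g≗h _)

nbrSum-+ : ∀ {p q} (g h : Vtx (suc p) (suc q) → ℕ) v → nbrSum (λ u → g u + h u) v ≡ nbrSum g v + nbrSum h v
nbrSum-+ g h (i , j) = regroup (g (prev i , j)) (g (next i , j)) (g (i , prev j)) (g (i , next j))
                               (h (prev i , j)) (h (next i , j)) (h (i , prev j)) (h (i , next j))
  where
  regroup : ∀ a b c d a′ b′ c′ d′ →
    a + a′ + (b + b′) + (c + c′) + (d + d′) ≡ a + b + c + d + (a′ + b′ + c′ + d′)
  regroup = solve-∀

bit : Bool → ℕ
bit true  = 1
bit false = 0

card≡bit+bit : ∀ l → card l ≡ bit (has1 l) + bit (has2 l)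
card≡bit+bit (true  , true)  = refl
card≡bit+bit (true  , false) = refl
card≡bit+bit (false , true)  = refl
card≡bit+bit (false , false) = refl

2≤2*card+N : ∀ l {N} → (l ≡ empty → 2 ≤ N) → 2 ≤ 2 * card l + N
2≤2*card+N (true  , true)  _   = s≤s (s≤s z≤n)
2≤2*card+N (true  , false) _   = s≤s (s≤s z≤n)
2≤2*card+N (false , true)  _   = s≤s (s≤s z≤n)
2≤2*card+N (false , false) 2≤N = 2≤N refl

2≤2*card+nbrSum : ∀ {p q} {f : Vtx (suc p) (suc q) → Label} → Is2RDF (suc p) (suc q) f →
  ∀ v → 2 ≤ 2 * card (f v) + nbrSum (card ∘ f) v
2≤2*card+nbrSum {f = f} rdf v = 2≤2*card+N (f v) λ fv≡∅ →
  let (u₁ , v~u₁ , 1∈fu₁) , (u₂ , v~u₂ , 2∈fu₂) = rdf v fv≡∅ in begin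
    1 + 1                                     ≤⟨ +-mono-≤ (coloured has1 v~u₁ 1∈fu₁) (coloured has2 v~u₂ 2∈fu₂) ⟩
    nbrSum (colour has1) v + nbrSum (colour has2) v  ≡⟨ nbrSum-+ (colour has1) (colour has2) v ⟨
    nbrSum (λ u → colour has1 u + colour has2 u) v    ≡⟨ nbrSum-cong (card≡bit+bit ∘ f) v ⟨
    nbrSum (card ∘ f) v                       ∎
  where
  open ≤-Reasoning
  colour : (Label → Bool) → Vtx _ _ → ℕ
  colour has u = bit (has (f u))
  coloured : ∀ has {u} → Adj _ _ v u → has (f u) ≡ true → 1 ≤ nbrSum (colour has) v
  coloured has v~u has-fu = ≤-trans (≤-reflexive (cong bit (sym has-fu))) (Adj⇒≤nbrSum (colour has) v~u)

column : ∀ {m n} → (Vtx m n → ℕ) → Fin n → ℕ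
column g j = sum (λ i → g (i , j))

∑-nbrSum : ∀ {p q} (g : Vtx (suc p) (suc q) → ℕ) j →
  sum (λ i → nbrSum g (i , j)) ≡ column g j + column g j + column g (prev j) + column g (next j)
∑-nbrSum g j = begin
  sum (λ i → up i + down i + g (i , prev j) + g (i , next j))
    ≡⟨ ∑-distrib-+ (λ i → up i + down i + g (i , prev j)) (λ i → g (i , next j)) ⟩
  sum (λ i → up i + down i + g (i , prev j)) + column g (next j)
    ≡⟨ cong (_+ column g (next j)) (∑-distrib-+ (λ i → up i + down i) (λ i → g (i , prev j))) ⟩
  sum (λ i → up i + down i) + column g (prev j) + column g (next j)
    ≡⟨ cong (λ x → x + column g (prev j) + column g (next j)) (∑-distrib-+ up down) ⟩
  sum up + sum down + column g (prev j) + column g (next j)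
    ≡⟨ cong (λ x → x + column g (prev j) + column g (next j))
            (cong₂ _+_ (∑-prev (λ i → g (i , j))) (∑-next (λ i → g (i , j)))) ⟩
  column g j + column g j + column g (prev j) + column g (next j)
    ∎
  where
  open ≡-Reasoning
  up down : Fin _ → ℕ
  up   i = g (prev i , j)
  down i = g (next i , j)

column-bound : ∀ {p q} {f : Vtx (suc p) (suc q) → Label} → Is2RDF (suc p) (suc q) f → ∀ j →
  2 * suc p ≤ column (card ∘ f) (prev j) + 4 * column (card ∘ f) j + column (card ∘ f) (next j)
column-bound {p} {f = f} rdf j = begin
  2 * suc p                                                ≡⟨ *-comm 2 (suc p) ⟩
  suc p * 2                                                ≡⟨ ∑-const (suc p) 2 ⟨
  sum {suc p} (λ _ → 2)                                    ≤⟨ ∑-mono-≤ (λ i → 2≤2*card+nbrSum rdf (i , j)) ⟩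
  sum (λ i → 2 * w (i , j) + nbrSum w (i , j))             ≡⟨ ∑-distrib-+ (λ i → 2 * w (i , j)) (λ i → nbrSum w (i , j)) ⟩
  sum (λ i → 2 * w (i , j)) + sum (λ i → nbrSum w (i , j)) ≡⟨ cong₂ _+_ (sym (*-distribˡ-sum 2 (λ i → w (i , j)))) (∑-nbrSum w j) ⟩
  2 * column w j + (column w j + column w j + column w (prev j) + column w (next j))
    ≡⟨ regroup (column w j) (column w (prev j)) (column w (next j)) ⟩
  column w (prev j) + 4 * column w j + column w (next j)   ∎
  where
  open ≤-Reasoning
  w : Vtx _ _ → ℕ
  w = card ∘ f
  regroup : ∀ x y z → 2 * x + (x + x + y + z) ≡ y + 4 * x + z
  regroup = solve-∀

weight≡∑column : ∀ m n (f : Vtx m n → Label) → weight m n f ≡ sum (column (card ∘ f))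
weight≡∑column m n f = begin
  weight m n f
    ≡⟨ sum-map-tabulate (λ i → List.sum (map (λ j → card (f (i , j))) (allFin n))) (λ i → i) ⟩
  sum (λ i → List.sum (map (λ j → card (f (i , j))) (allFin n)))
    ≡⟨ sum-cong-≗ (λ i → sum-map-tabulate (λ j → card (f (i , j))) (λ j → j)) ⟩
  sum (λ i → sum (λ j → card (f (i , j))))
    ≡⟨ ∑-comm (λ i j → card (f (i , j))) ⟩
  sum (column (card ∘ f))
    ∎
  where open ≡-Reasoning

-- The hypotheses 3 ≤ m and 3 ≤ n are used only to know that m and n are nonzero.
proposition1 : (m n : ℕ) → 3 ≤ m → 3 ≤ n →
    (f : Vtx m n → Label) → Is2RDF m n f →
    2 * ((m / 3) * n) + (m % 3) * n ≤ 2 * weight m n f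
proposition1 m@(suc p) n@(suc q) _ _ f rdf = begin
  2 * (k * n) + ℓ * n               ≡⟨ scale k ℓ n ⟩
  n * s                             ≤⟨ ∑-discharging s (λ j → 2 * column w j) covered ⟩
  sum (λ j → 2 * column w j)        ≡⟨ *-distribˡ-sum 2 (column w) ⟨
  2 * sum (column w)                ≡⟨ cong (2 *_) (weight≡∑column m n f) ⟨
  2 * weight m n f                  ∎
  where
  open ≤-Reasoning
  k ℓ s : ℕ
  k = m / 3
  ℓ = m % 3
  s = 2 * k + ℓ
  w : Vtx m n → ℕ
  w = card ∘ f
  scale : ∀ k ℓ n → 2 * (k * n) + ℓ * n ≡ n * (2 * k + ℓ)
  scale = solve-∀
  2m≡2s+2k : 2 * m ≡ 2 * s + 2 * k
  2m≡2s+2k = trans (cong (2 *_) (m≡m%n+[m/n]*n m 3)) (split k ℓ)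
    where
    split : ∀ k ℓ → 2 * (ℓ + k * 3) ≡ 2 * (2 * k + ℓ) + 2 * k
    split = solve-∀
  covered : ∀ j → 2 * (s ∸ 2 * column w j) ≤ (2 * column w (prev j) ∸ s) + (2 * column w (next j) ∸ s)
  covered j = deficit-covered s k (column w (prev j)) (column w j) (column w (next j))
                (2*b<2*k+ℓ⇒b≤k (≤-pred (m%n<n m 3)))
                (≤-trans (≤-reflexive (sym 2m≡2s+2k)) (column-bound rdf j))
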